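{- Let $v\ge4$. As formal power series in $y$, \[1+\sum_{d=1}^\infty \sum_{D \in \mathcal{D}_{v,d}(132,321)} x^{des(\pi_D)}y^d = \frac{1-2y+y^2+vxy^2}{(1-y)^3}.\]
   Context: A diamond with $v$ vertices ($v\ge4$) is the poset with a least element, a greatest element, and $v-2$ pairwise incomparable middle elements (in a fixed left-to-right order) strictly between them. $\mathcal{D}_{v,d}$ is the set of labellings of $d$ diamonds (placed left to right) by $1,\dots,vd$, each label used once, such that in each diamond least label $<$ each middle label $<$ greatest label. For $D\in\mathcal{D}_{v,d}$, $\pi_D$ is the permutation obtained by reading the diamonds left to right and, within each diamond, the least element, then the middle elements left to right, then the greatest element. $\mathcal{D}_{v,d}(P)$ is the set of $D$ with $\pi_D$ avoiding every classical pattern in $P$. $des(\pi)$ is the number of $i$ with $\pi_i>\pi_{i+1}$. -}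

module Defs where

open import Data.Nat using (ℕ; zero; suc; _∸_; _<ᵇ_; _≡ᵇ_)
import Data.Nat as ℕ
open import Data.Integer using (ℤ; +_; -_)
import Data.Integer as ℤ
open import Data.Bool using (Bool; true; false; _∧_; not; if_then_else_)
open import Data.List using (List; []; _∷_; _++_; map; concatMap; length;
  take; drop; null; zip; cartesianProduct; filterᵇ; upTo; unsnoc; foldr)
open import Data.Bool.ListAction using (all; any)
open import Data.Maybe using (Maybe; just; nothing)
open import Data.Product using (_×_; _,_)

insertions : {A : Set} → A → List A → List (List A)
insertions x [] = (x ∷ []) ∷ []
insertions x (y ∷ ys) = (x ∷ y ∷ ys) ∷ map (y ∷_) (insertions x ys)

permutations : {A : Set} → List A → List (List A)
permutations [] = [] ∷ []
permutations (x ∷ xs) = concatMap (insertions x) (permutations xs)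

subseqs : {A : Set} → ℕ → List A → List (List A)
subseqs zero _ = [] ∷ []
subseqs (suc k) [] = []
subseqs (suc k) (x ∷ xs) = map (x ∷_) (subseqs k xs) ++ subseqs (suc k) xs

orderIso : List ℕ → List ℕ → Bool
orderIso p s = (length p ≡ᵇ length s) ∧
  all (λ { ((a , a') , (b , b')) → eqB (a <ᵇ b) (a' <ᵇ b') })
      (cartesianProduct (zip p s) (zip p s))
  where
  eqB : Bool → Bool → Bool
  eqB true true = true
  eqB false false = true
  eqB _ _ = false

contains : List ℕ → List ℕ → Bool
contains p w = any (orderIso p) (subseqs (length p) w)

avoidsAll : List (List ℕ) → List ℕ → Bool
avoidsAll P w = all (λ p → not (contains p w)) P

p132 p321 : List ℕ
p132 = 1 ∷ 3 ∷ 2 ∷ []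
p321 = 3 ∷ 2 ∷ 1 ∷ []

des : List ℕ → ℕ
des (a ∷ b ∷ t) = (if b <ᵇ a then 1 else 0) ℕ.+ des (b ∷ t)
des _ = 0

-- A labelling D ∈ 𝒟_{v,d} is identified with its reading word
-- π_D (least, middles left to right, greatest, diamond by diamond); this
-- is a bijection between labellings of d diamonds by 1..vd and permutations
-- of 1..vd whose consecutive blocks of length v satisfy the diamond condition.

blockOK : List ℕ → Bool
blockOK [] = false
blockOK (a ∷ rest) with unsnoc rest
... | nothing = false
... | just (ms , c) = all (a <ᵇ_) ms ∧ all (_<ᵇ c) ms

diamondsOK : ℕ → ℕ → List ℕ → Bool
diamondsOK v zero w = null w
diamondsOK v (suc d) w = (length (take v w) ≡ᵇ v) ∧ blockOK (take v w) ∧ diamondsOK v d (drop v w)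

labels : ℕ → List ℕ
labels n = map suc (upTo n)

diamondWords : ℕ → ℕ → List (List ℕ)
diamondWords v d = filterᵇ (diamondsOK v d) (permutations (labels (v ℕ.* d)))

countD : ℕ → ℕ → ℕ → ℕ
countD v d i = length (filterᵇ (λ w → avoidsAll (p132 ∷ p321 ∷ []) w ∧ (des w ≡ᵇ i))
                               (diamondWords v d))

-- Formal power series in y with coefficients in ℤ[x]:
-- s d i = coefficient of x^i y^d.

Series₂ : Set
Series₂ = ℕ → ℕ → ℤ

Σ≤ : ℕ → (ℕ → ℤ) → ℤ
Σ≤ n f = foldr ℤ._+_ (+ 0) (map f (upTo (suc n)))

_*ₛ_ : Series₂ → Series₂ → Series₂
(a *ₛ b) d i = Σ≤ d (λ j → Σ≤ i (λ k → a j k ℤ.* b (d ∸ j) (i ∸ k)))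

genFun : ℕ → Series₂
genFun v zero zero = + 1
genFun v zero (suc i) = + 0
genFun v (suc d) i = + countD v (suc d) i

oneMinusY : Series₂
oneMinusY zero zero = + 1
oneMinusY 1 zero = - (+ 1)
oneMinusY _ _ = + 0

oneMinusYCubed : Series₂
oneMinusYCubed = oneMinusY *ₛ (oneMinusY *ₛ oneMinusY)

numer : ℕ → Series₂
numer v 0 0 = + 1
numer v 1 0 = - (+ 2)
numer v 2 0 = + 1
numer v 2 1 = + v
numer v _ _ = + 0

module Submission where

-- A permutation avoiding 132 and 321 is either the identity or, writing it as A ++ 1 ∷ B, the block
-- swap (c+1 … c+p) (1 … c) (c+p+1 … n) with c, p ≥ 1, which has exactly one descent. It is the
-- reading word of a diamond labelling iff both increasing runs consist of whole diamonds, that is iff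
-- v ∣ p, because 1 cannot lie above a larger least element. So d diamonds carry one labelling without
-- descents, v·C(d,2) with one descent and none with more: the series is 1/(1-y) + v x y²/(1-y)³.
-- Multiplying by (1-y)³ takes third differences in d, which vanish on constant and quadratic sequences.

open import Defs
open import Data.Nat using (ℕ; zero; suc; _+_; _*_; _∸_; _<_; _≤_; _<ᵇ_; _≡ᵇ_; _≤?_; z≤n; s≤s; z<s; >-nonZero)
open import Data.Nat.Properties
open import Data.Nat.Combinatorics using (_C_; nC1≡n; nCk+nC[k+1]≡[n+1]C[k+1])
open import Data.Nat.Divisibility using (_∣_; divides; _∣0; ∣-refl; ∣m∸n∣n⇒∣m)
open import Data.Integer using (ℤ; +_; -_)
import Data.Integer as ℤ
import Data.Integer.Properties as ℤ
open import Data.Integer.Tactic.RingSolver using (solve-∀)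
open import Data.Bool using (Bool; true; false; T; _∧_; not)
open import Data.Bool.Properties using (T-∧; T-≡)
open import Data.Bool.ListAction using (all)
open import Data.Product using (∃; ∃₂; _×_; _,_; proj₁; proj₂)
open import Data.Sum using (_⊎_; inj₁; inj₂)
open import Data.Empty using (⊥-elim)
open import Function using (_∘_; _⇔_; mk⇔; Equivalence)
open import Relation.Nullary using (¬_; yes; no; contradiction)
open import Relation.Nullary.Decidable using (T?)
open import Relation.Binary.Definitions using (Tri; tri<; tri≈; tri>)
open import Relation.Binary.PropositionalEquality
  using (_≡_; _≢_; refl; sym; trans; cong; cong₂; subst; isEquivalence; setoid; module ≡-Reasoning)
open import Data.List
  using (List; []; _∷_; _++_; map; foldr; upTo; concatMap; length; take; drop; filterᵇ; zip; initLast; _∷ʳ′_)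
import Data.List.Properties as List
open import Data.List.Membership.Propositional using (_∈_; _∉_; lose; find)
open import Data.List.Membership.Propositional.Properties
  using (∈-++⁺ˡ; ∈-++⁺ʳ; ∈-++⁻; ∈-map⁺; ∈-map⁻; ∈-∃++; ∈-filter⁺; ∈-filter⁻; ∈-cartesianProduct⁺)
open import Data.List.Membership.Propositional.Properties.WithK using (unique∧set⇒bag)
open import Data.List.Relation.Unary.Any using (here; there)
import Data.List.Relation.Unary.Any.Properties as Any
open import Data.List.Relation.Unary.All as All using ([]; _∷_)
open import Data.List.Relation.Unary.AllPairs as AllPairs using (AllPairs; []; _∷_)
import Data.List.Relation.Unary.AllPairs.Properties as AllPairs
open import Data.List.Relation.Unary.Linked as Linked using (Linked)
open import Data.List.Relation.Unary.Linked.Properties using (AllPairs⇒Linked)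
open import Data.List.Relation.Unary.Sorted.TotalOrder.Properties using (↗↭↗⇒≋)
open import Data.List.Relation.Unary.Unique.Propositional using (Unique)
import Data.List.Relation.Unary.Unique.Propositional.Properties as Unique
open import Data.List.Relation.Binary.Pointwise using (Pointwise-≡⇒≡)
open import Data.List.Relation.Binary.Sublist.Propositional using (_⊆_; []; _∷_; _∷ʳ_; to∈; from∈)
import Data.List.Relation.Binary.Sublist.Propositional.Properties as Sublist
open import Data.List.Relation.Binary.Permutation.Propositional
  using (_↭_; ↭-refl; ↭-sym; ↭-trans; prep; ↭⇒↭ₛ; ↭⇒↭ₛ′)
open import Data.List.Relation.Binary.Permutation.Propositional.Properties
  using (∈-resp-↭; ↭-length; ↭-empty-inv; drop-mid; drop-∷; shift; shifts)
import Data.List.Relation.Binary.Permutation.Setoid.Properties as Permutationₛ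
open import Data.List.Relation.Binary.BagAndSetEquality using (∼bag⇒↭)

∈-insertions⁺ : ∀ {A : Set} (x : A) pre post → pre ++ x ∷ post ∈ insertions x (pre ++ post)
∈-insertions⁺ x [] [] = here refl
∈-insertions⁺ x [] (y ∷ post) = here refl
∈-insertions⁺ x (y ∷ pre) post = there (∈-map⁺ (y ∷_) (∈-insertions⁺ x pre post))

∈-insertions⁻ : ∀ {A : Set} (x : A) ys {u} → u ∈ insertions x ys →
  ∃₂ λ pre post → u ≡ pre ++ x ∷ post × ys ≡ pre ++ post
∈-insertions⁻ x [] (here refl) = [] , [] , refl , refl
∈-insertions⁻ x (y ∷ ys) (here refl) = [] , y ∷ ys , refl , refl
∈-insertions⁻ x (y ∷ ys) (there u∈) with ∈-map⁻ (y ∷_) u∈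
... | u′ , u′∈ , refl with ∈-insertions⁻ x ys u′∈
... | pre , post , refl , refl = y ∷ pre , post , refl , refl

∈-concatMap⁺ : ∀ {A B : Set} (f : A → List B) {x xs u} → x ∈ xs → u ∈ f x → u ∈ concatMap f xs
∈-concatMap⁺ f x∈ u∈ = Any.concatMap⁺ f (lose x∈ u∈)

∈-concatMap⁻ : ∀ {A B : Set} (f : A → List B) {xs u} → u ∈ concatMap f xs → ∃ λ x → x ∈ xs × u ∈ f x
∈-concatMap⁻ f u∈ = find (Any.concatMap⁻ f u∈)

∈-permutations⁻ : ∀ {A : Set} {xs u : List A} → u ∈ permutations xs → u ↭ xs
∈-permutations⁻ {xs = []} (here refl) = ↭-refl
∈-permutations⁻ {xs = x ∷ xs} u∈ with ∈-concatMap⁻ (insertions x) u∈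
... | ys , ys∈ , u∈′ with ∈-insertions⁻ x ys u∈′
... | pre , post , refl , refl = ↭-trans (shift x pre post) (prep x (∈-permutations⁻ ys∈))

∈-permutations⁺ : ∀ {A : Set} (xs : List A) {u} → u ↭ xs → u ∈ permutations xs
∈-permutations⁺ [] {[]} _ = here refl
∈-permutations⁺ [] {_ ∷ _} u↭ with ↭-length u↭
... | ()
∈-permutations⁺ (x ∷ xs) {u} u↭ = insert (∈-∃++ (∈-resp-↭ (↭-sym u↭) (here refl)))
  where
  insert : (∃₂ λ pre post → u ≡ pre ++ x ∷ post) → u ∈ permutations (x ∷ xs)
  insert (pre , post , refl) =
    ∈-concatMap⁺ (insertions x) (∈-permutations⁺ xs (drop-mid pre [] u↭)) (∈-insertions⁺ x pre post)

++-∷-injective : ∀ {A : Set} {x : A} pre pre′ {post post′} → x ∉ pre → x ∉ pre′ →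
  pre ++ x ∷ post ≡ pre′ ++ x ∷ post′ → pre ≡ pre′ × post ≡ post′
++-∷-injective [] [] _ _ refl = refl , refl
++-∷-injective [] (y ∷ pre′) _ x∉ refl = ⊥-elim (x∉ (here refl))
++-∷-injective (y ∷ pre) [] x∉ _ refl = ⊥-elim (x∉ (here refl))
++-∷-injective (y ∷ pre) (y′ ∷ pre′) x∉ x∉′ eq with List.∷-injective eq
... | refl , eq′ with ++-∷-injective pre pre′ (x∉ ∘ there) (x∉′ ∘ there) eq′
... | refl , refl = refl , refl

insertions-injective : ∀ {A : Set} (x : A) {ys zs u} → x ∉ ys → x ∉ zs →
  u ∈ insertions x ys → u ∈ insertions x zs → ys ≡ zs
insertions-injective x {ys} {zs} x∉ys x∉zs u∈ u∈′
  with ∈-insertions⁻ x ys u∈ | ∈-insertions⁻ x zs u∈′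
... | pre , post , refl , refl | pre′ , post′ , eq , refl
  with ++-∷-injective pre pre′ (x∉ys ∘ ∈-++⁺ˡ) (x∉zs ∘ ∈-++⁺ˡ) eq
... | refl , refl = refl

insertions-unique : ∀ {A : Set} (x : A) ys → x ∉ ys → Unique (insertions x ys)
insertions-unique x [] _ = [] ∷ []
insertions-unique x (y ∷ ys) x∉ =
  All.tabulate head-new ∷ Unique.map⁺ List.∷-injectiveʳ (insertions-unique x ys (x∉ ∘ there))
  where
  head-new : ∀ {u} → u ∈ map (y ∷_) (insertions x ys) → x ∷ y ∷ ys ≢ u
  head-new u∈ eq with ∈-map⁻ (y ∷_) u∈
  ... | _ , _ , refl with List.∷-injectiveˡ eq
  ... | refl = x∉ (here refl)

concatMap-unique : ∀ {A B : Set} (f : A → List B) {xs} → Unique xs →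
  (∀ {x} → x ∈ xs → Unique (f x)) →
  (∀ {x y u} → x ∈ xs → y ∈ xs → u ∈ f x → u ∈ f y → x ≡ y) →
  Unique (concatMap f xs)
concatMap-unique f {[]} _ _ _ = []
concatMap-unique f {x ∷ xs} (x∉ ∷ xs!) f! f-disj =
  Unique.++⁺ (f! (here refl))
    (concatMap-unique f xs! (f! ∘ there) (λ x∈ y∈ → f-disj (there x∈) (there y∈)))
    disjoint
  where
  disjoint : ∀ {u} → ¬ (u ∈ f x × u ∈ concatMap f xs)
  disjoint (u∈fx , u∈) with ∈-concatMap⁻ f u∈
  ... | y , y∈ , u∈fy = All.lookup x∉ y∈ (f-disj (here refl) (there y∈) u∈fx u∈fy)

permutations-unique : ∀ {A : Set} {xs : List A} → Unique xs → Unique (permutations xs)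
permutations-unique {xs = []} _ = [] ∷ []
permutations-unique {xs = x ∷ xs} (x∉ ∷ xs!) =
  concatMap-unique (insertions x) (permutations-unique xs!)
    (λ ys∈ → insertions-unique x _ (fresh ys∈))
    (λ ys∈ zs∈ → insertions-injective x (fresh ys∈) (fresh zs∈))
  where
  fresh : ∀ {ys} → ys ∈ permutations xs → x ∉ ys
  fresh ys∈ x∈ = All.lookup x∉ (∈-resp-↭ (∈-permutations⁻ ys∈) x∈) refl

T-all⁻ : ∀ {A : Set} (p : A → Bool) {xs x} → T (all p xs) → x ∈ xs → T (p x)
T-all⁻ p {y ∷ xs} h (here refl) = proj₁ (Equivalence.to T-∧ h)
T-all⁻ p {y ∷ xs} h (there x∈) = T-all⁻ p (proj₂ (Equivalence.to (T-∧ {p y}) h)) x∈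

T-all⁺ : ∀ {A : Set} (p : A → Bool) {xs} → (∀ {x} → x ∈ xs → T (p x)) → T (all p xs)
T-all⁺ p {[]} _ = _
T-all⁺ p {y ∷ xs} h = Equivalence.from T-∧ (h (here refl) , T-all⁺ p (h ∘ there))

orderIso-sound : ∀ {p s x x′ y y′} → T (orderIso p s) →
  (x , x′) ∈ zip p s → (y , y′) ∈ zip p s → (x <ᵇ y) ≡ (x′ <ᵇ y′)
orderIso-sound {p} {s} {x} {x′} {y} {y′} iso x∈ y∈
  with x <ᵇ y | x′ <ᵇ y′
     | T-all⁻ _ (proj₂ (Equivalence.to (T-∧ {length p ≡ᵇ length s}) iso)) (∈-cartesianProduct⁺ x∈ y∈)
... | true | true | _ = refl
... | false | false | _ = refl

T-not : ∀ {b} → T (not b) ⇔ (¬ T b)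
T-not {true} = mk⇔ (λ ()) (λ ¬t → ¬t _)
T-not {false} = mk⇔ (λ _ ()) (λ _ → _)

<ᵇ-true : ∀ {m n} → m < n → (m <ᵇ n) ≡ true
<ᵇ-true m<n = Equivalence.to T-≡ (<⇒<ᵇ m<n)

<ᵇ-false : ∀ {m n} → n ≤ m → (m <ᵇ n) ≡ false
<ᵇ-false {m} {n} n≤m with m <ᵇ n in eq
... | false = refl
... | true = contradiction (<ᵇ⇒< m n (subst T (sym eq) _)) (≤⇒≯ n≤m)

true≡<ᵇ⇒< : ∀ {m n} → true ≡ (m <ᵇ n) → m < n
true≡<ᵇ⇒< {m} {n} eq = <ᵇ⇒< m n (subst T eq _)

Occurs : (ℕ → ℕ → ℕ → Set) → List ℕ → Set
Occurs R w = ∃ λ a → ∃ λ b → ∃ λ c → (a ∷ b ∷ c ∷ []) ⊆ w × R a b c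

Is132 Is321 : ℕ → ℕ → ℕ → Set
Is132 a b c = a < c × c < b
Is321 a b c = c < b × b < a

orderIso-132 : ∀ {a b c} → T (orderIso p132 (a ∷ b ∷ c ∷ [])) ⇔ Is132 a b c
orderIso-132 {a} {b} {c} = mk⇔ sound complete
  where
  sound : T (orderIso p132 (a ∷ b ∷ c ∷ [])) → Is132 a b c
  sound iso = true≡<ᵇ⇒< (orderIso-sound {p132} {a ∷ b ∷ c ∷ []} iso (here refl) (there (there (here refl))))
            , true≡<ᵇ⇒< (orderIso-sound {p132} {a ∷ b ∷ c ∷ []} iso (there (there (here refl))) (there (here refl)))
  complete : Is132 a b c → T (orderIso p132 (a ∷ b ∷ c ∷ []))
  complete (a<c , c<b)
    rewrite <ᵇ-false {a} ≤-refl | <ᵇ-false {b} ≤-refl | <ᵇ-false {c} ≤-refl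
          | <ᵇ-true (<-trans a<c c<b) | <ᵇ-false {b} (<⇒≤ (<-trans a<c c<b))
          | <ᵇ-true a<c | <ᵇ-false {c} (<⇒≤ a<c) | <ᵇ-true c<b | <ᵇ-false {b} (<⇒≤ c<b) = _

orderIso-321 : ∀ {a b c} → T (orderIso p321 (a ∷ b ∷ c ∷ [])) ⇔ Is321 a b c
orderIso-321 {a} {b} {c} = mk⇔ sound complete
  where
  sound : T (orderIso p321 (a ∷ b ∷ c ∷ [])) → Is321 a b c
  sound iso = true≡<ᵇ⇒< (orderIso-sound {p321} {a ∷ b ∷ c ∷ []} iso (there (there (here refl))) (there (here refl)))
            , true≡<ᵇ⇒< (orderIso-sound {p321} {a ∷ b ∷ c ∷ []} iso (there (here refl)) (here refl))
  complete : Is321 a b c → T (orderIso p321 (a ∷ b ∷ c ∷ []))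
  complete (c<b , b<a)
    rewrite <ᵇ-false {a} ≤-refl | <ᵇ-false {b} ≤-refl | <ᵇ-false {c} ≤-refl
          | <ᵇ-true (<-trans c<b b<a) | <ᵇ-false {a} (<⇒≤ (<-trans c<b b<a))
          | <ᵇ-true b<a | <ᵇ-false {a} (<⇒≤ b<a) | <ᵇ-true c<b | <ᵇ-false {b} (<⇒≤ c<b) = _

∈-subseqs⁺ : ∀ {A : Set} {s w : List A} → s ⊆ w → s ∈ subseqs (length s) w
∈-subseqs⁺ {s = []} _ = here refl
∈-subseqs⁺ {s = _ ∷ _} (y ∷ʳ s⊆) = ∈-++⁺ʳ _ (∈-subseqs⁺ s⊆)
∈-subseqs⁺ (refl ∷ s⊆) = ∈-++⁺ˡ (∈-map⁺ _ (∈-subseqs⁺ s⊆))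

∈-subseqs⁻ : ∀ {A : Set} k {s w : List A} → s ∈ subseqs k w → s ⊆ w × length s ≡ k
∈-subseqs⁻ zero {w = []} (here refl) = [] , refl
∈-subseqs⁻ zero {w = y ∷ w} (here refl) = y ∷ʳ proj₁ (∈-subseqs⁻ zero {w = w} (here refl)) , refl
∈-subseqs⁻ (suc k) {w = y ∷ w} s∈ with ∈-++⁻ (map (y ∷_) (subseqs k w)) s∈
... | inj₂ s∈′ = let s⊆ , len = ∈-subseqs⁻ (suc k) s∈′ in y ∷ʳ s⊆ , len
... | inj₁ s∈′ with ∈-map⁻ (y ∷_) s∈′
... | _ , t∈ , refl = let t⊆ , len = ∈-subseqs⁻ k t∈ in refl ∷ t⊆ , cong suc len

contains-triple : ∀ {x y z R} →
  (∀ {a b c} → T (orderIso (x ∷ y ∷ z ∷ []) (a ∷ b ∷ c ∷ [])) ⇔ R a b c) →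
  ∀ w → T (contains (x ∷ y ∷ z ∷ []) w) ⇔ Occurs R w
contains-triple {x} {y} {z} iso⇔ w = mk⇔ to from
  where
  to : T (contains (x ∷ y ∷ z ∷ []) w) → Occurs _ w
  to h with find (Any.any⁻ (orderIso (x ∷ y ∷ z ∷ [])) (subseqs 3 w) h)
  ... | s , s∈ , iso with ∈-subseqs⁻ 3 {w = w} s∈
  ... | s⊆ , len with s | len
  ... | a ∷ b ∷ c ∷ [] | refl = a , b , c , s⊆ , Equivalence.to iso⇔ iso
  from : Occurs _ w → T (contains (x ∷ y ∷ z ∷ []) w)
  from (a , b , c , s⊆ , r) =
    Any.any⁺ (orderIso (x ∷ y ∷ z ∷ [])) (lose (∈-subseqs⁺ s⊆) (Equivalence.from iso⇔ r))

Avoids : List ℕ → Set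
Avoids w = ¬ Occurs Is132 w × ¬ Occurs Is321 w

avoidsAll⇔Avoids : ∀ w → T (avoidsAll (p132 ∷ p321 ∷ []) w) ⇔ Avoids w
avoidsAll⇔Avoids w = mk⇔ to from
  where
  132⇔ : T (contains p132 w) ⇔ Occurs Is132 w
  132⇔ = contains-triple orderIso-132 w
  321⇔ : T (contains p321 w) ⇔ Occurs Is321 w
  321⇔ = contains-triple orderIso-321 w
  to : T (avoidsAll (p132 ∷ p321 ∷ []) w) → Avoids w
  to h with Equivalence.to T-∧ h
  ... | ¬132 , rest =
    Equivalence.to T-not ¬132 ∘ Equivalence.from 132⇔ ,
    Equivalence.to T-not (proj₁ (Equivalence.to T-∧ rest)) ∘ Equivalence.from 321⇔
  from : Avoids w → T (avoidsAll (p132 ∷ p321 ∷ []) w)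
  from (¬132 , ¬321) = Equivalence.from T-∧
    ( Equivalence.from T-not (¬132 ∘ Equivalence.to 132⇔)
    , Equivalence.from T-∧ (Equivalence.from T-not (¬321 ∘ Equivalence.to 321⇔) , _))

range : ℕ → ℕ → List ℕ
range a zero = []
range a (suc k) = a ∷ range (suc a) k

∈-range⁻ : ∀ {a k z} → z ∈ range a k → a ≤ z × z < a + k
∈-range⁻ {a} {suc k} (here refl) = ≤-refl , m<m+n a z<s
∈-range⁻ {a} {suc k} {z} (there z∈) with ∈-range⁻ {suc a} {k} z∈
... | a<z , z<a+k = <⇒≤ a<z , subst (z <_) (sym (+-suc a k)) z<a+k

∈-range⁺ : ∀ {a k z} → a ≤ z → z < a + k → z ∈ range a k
∈-range⁺ {a} {zero} a≤z z<a = contradiction a≤z (<⇒≱ (subst (_ <_) (+-identityʳ a) z<a))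
∈-range⁺ {a} {suc k} {z} a≤z z<a+k with m≤n⇒m<n∨m≡n a≤z
... | inj₂ refl = here refl
... | inj₁ a<z = there (∈-range⁺ a<z (subst (z <_) (+-suc a k) z<a+k))

length-range : ∀ a k → length (range a k) ≡ k
length-range a zero = refl
length-range a (suc k) = cong suc (length-range (suc a) k)

range-++ : ∀ a k l → range a (k + l) ≡ range a k ++ range (a + k) l
range-++ a zero l = cong (λ b → range b l) (sym (+-identityʳ a))
range-++ a (suc k) l =
  cong (a ∷_) (trans (range-++ (suc a) k l) (cong (λ b → range (suc a) k ++ range b l) (sym (+-suc a k))))

∈-range-last : ∀ a k → a + k ∈ range a (suc k)
∈-range-last a k = ∈-range⁺ (m≤m+n a k) (+-monoʳ-< a (n<1+n k))

labels≡range : ∀ n → labels n ≡ range 1 n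
labels≡range n = trans (List.map-applyUpTo (λ i → i) suc n) (applyUpTo≡range 1 n λ i → +-comm 1 i)
  where
  applyUpTo≡range : ∀ a n {f} → (∀ i → f i ≡ i + a) → Data.List.applyUpTo f n ≡ range a n
  applyUpTo≡range a zero _ = refl
  applyUpTo≡range a (suc n) f≗ =
    cong₂ _∷_ (f≗ 0) (applyUpTo≡range (suc a) n λ i → trans (f≗ (suc i)) (sym (+-suc i a)))

Increasing : List ℕ → Set
Increasing = AllPairs _<_

range-increasing : ∀ a k → Increasing (range a k)
range-increasing a zero = []
range-increasing a (suc k) = All.tabulate (proj₁ ∘ ∈-range⁻) ∷ range-increasing (suc a) k

AllPairs-⊆ : ∀ {A : Set} {R : A → A → Set} {x y xs} → AllPairs R xs → (x ∷ y ∷ []) ⊆ xs → R x y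
AllPairs-⊆ (_ ∷ Rxs) (_ ∷ʳ xy⊆) = AllPairs-⊆ Rxs xy⊆
AllPairs-⊆ (Rx ∷ _) (refl ∷ y⊆) = All.lookup Rx (to∈ y⊆)

AllPairs-fromPairs : ∀ {A : Set} {R : A → A → Set} {xs} →
  (∀ {x y} → (x ∷ y ∷ []) ⊆ xs → R x y) → AllPairs R xs
AllPairs-fromPairs {xs = []} _ = []
AllPairs-fromPairs {xs = x ∷ xs} R⊆ =
  All.tabulate (λ y∈ → R⊆ (refl ∷ from∈ y∈)) ∷ AllPairs-fromPairs (R⊆ ∘ (x ∷ʳ_))

increasing-↭⇒≡ : ∀ {xs ys} → Increasing xs → Increasing ys → xs ↭ ys → xs ≡ ys
increasing-↭⇒≡ xs↗ ys↗ xs↭ys =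
  Pointwise-≡⇒≡ (↗↭↗⇒≋ ≤-totalOrder (sorted xs↗) (sorted ys↗) (↭⇒↭ₛ′ isEquivalence xs↭ys))
  where
  sorted : ∀ {zs} → Increasing zs → Linked _≤_ zs
  sorted = Linked.map <⇒≤ ∘ AllPairs⇒Linked

increasing⇒unique : ∀ {xs} → Increasing xs → Unique xs
increasing⇒unique = AllPairs.map <⇒≢

unique-resp-↭ : ∀ {A : Set} {xs ys : List A} → xs ↭ ys → Unique xs → Unique ys
unique-resp-↭ {A} xs↭ys = Permutationₛ.Unique-resp-↭ (setoid A) (↭⇒↭ₛ xs↭ys)

++-cancelˡ-↭ : ∀ {A : Set} (xs : List A) {ys zs} → xs ++ ys ↭ xs ++ zs → ys ↭ zs
++-cancelˡ-↭ [] p = p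
++-cancelˡ-↭ (x ∷ xs) p = ++-cancelˡ-↭ xs (drop-∷ p)

-- Permutations avoiding 132 and 321

blockSwap : ℕ → ℕ → ℕ → List ℕ
blockSwap c p r = range (suc c) p ++ range 1 c ++ range (suc (c + p)) r

blockSwap-↭ : ∀ c p r → blockSwap c p r ↭ range 1 (c + p + r)
blockSwap-↭ c p r = subst (blockSwap c p r ↭_) unswapped (shifts (range (suc c) p) (range 1 c))
  where
  open ≡-Reasoning
  unswapped : range 1 c ++ range (suc c) p ++ range (suc (c + p)) r ≡ range 1 (c + p + r)
  unswapped = begin
    range 1 c ++ range (suc c) p ++ range (suc (c + p)) r   ≡⟨ List.++-assoc (range 1 c) _ _ ⟨
    (range 1 c ++ range (suc c) p) ++ range (suc (c + p)) r ≡⟨ cong (_++ range (suc (c + p)) r) (range-++ 1 c p) ⟨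
    range 1 (c + p) ++ range (suc (c + p)) r                ≡⟨ range-++ 1 (c + p) r ⟨
    range 1 (c + p + r)                                     ∎

blockSwap-tail-increasing : ∀ c p r → Increasing (range 1 c ++ range (suc (c + p)) r)
blockSwap-tail-increasing c p r = AllPairs.++⁺ (range-increasing 1 c) (range-increasing _ r)
  (All.tabulate λ x∈ → All.tabulate λ y∈ →
    <-≤-trans (proj₂ (∈-range⁻ x∈)) (≤-trans (s≤s (m≤m+n c p)) (proj₁ (∈-range⁻ y∈))))

blockSwap-degenerate : ∀ {c p} r → c ≡ 0 ⊎ p ≡ 0 → blockSwap c p r ≡ range 1 (c + p + r)
blockSwap-degenerate {p = p} r (inj₁ refl) = sym (range-++ 1 p r)
blockSwap-degenerate {c} r (inj₂ refl) = begin
  range 1 c ++ range (suc (c + 0)) r ≡⟨ cong (λ k → range 1 c ++ range (suc k) r) (+-identityʳ c) ⟩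
  range 1 c ++ range (suc c) r       ≡⟨ range-++ 1 c r ⟨
  range 1 (c + r)                    ≡⟨ cong (λ k → range 1 (k + r)) (+-identityʳ c) ⟨
  range 1 (c + 0 + r)                ∎
  where open ≡-Reasoning

⊆-++-split : ∀ {A : Set} {xs : List A} X {Y} → xs ⊆ X ++ Y →
  ∃₂ λ xs₁ xs₂ → xs ≡ xs₁ ++ xs₂ × xs₁ ⊆ X × xs₂ ⊆ Y
⊆-++-split [] s = [] , _ , refl , [] , s
⊆-++-split (x ∷ X) (.x ∷ʳ s) with ⊆-++-split X s
... | xs₁ , xs₂ , refl , s₁ , s₂ = xs₁ , xs₂ , refl , x ∷ʳ s₁ , s₂
⊆-++-split (x ∷ X) (refl ∷ s) with ⊆-++-split X s
... | xs₁ , xs₂ , refl , s₁ , s₂ = x ∷ xs₁ , xs₂ , refl , refl ∷ s₁ , s₂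

triple-⊆-++ : ∀ {A : Set} {a b c : A} X {Y} → (a ∷ b ∷ c ∷ []) ⊆ X ++ Y →
  (b ∷ c ∷ []) ⊆ X ⊎ ((a ∷ b ∷ []) ⊆ X × (c ∷ []) ⊆ Y) ⊎ (b ∷ c ∷ []) ⊆ Y
triple-⊆-++ X s with ⊆-++-split X s
... | [] , _ , refl , _ , s₂ = inj₂ (inj₂ (Sublist.∷ˡ⁻ s₂))
... | _ ∷ [] , _ , refl , _ , s₂ = inj₂ (inj₂ s₂)
... | _ ∷ _ ∷ [] , _ , refl , s₁ , s₂ = inj₂ (inj₁ (s₁ , s₂))
... | _ ∷ _ ∷ _ ∷ [] , [] , refl , s₁ , _ = inj₁ (Sublist.∷ˡ⁻ s₁)

blockSwap-avoids : ∀ c p r → Avoids (blockSwap c p r)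
blockSwap-avoids c p r = no132 , no321
  where
  head↗ : Increasing (range (suc c) p)
  head↗ = range-increasing (suc c) p
  tail↗ : Increasing (range 1 c ++ range (suc (c + p)) r)
  tail↗ = blockSwap-tail-increasing c p r
  no132 : ¬ Occurs Is132 (blockSwap c p r)
  no132 (a , b , c′ , s , a<c′ , c′<b) with triple-⊆-++ (range (suc c) p) s
  ... | inj₁ bc⊆ = <-asym c′<b (AllPairs-⊆ head↗ bc⊆)
  ... | inj₂ (inj₂ bc⊆) = <-asym c′<b (AllPairs-⊆ tail↗ bc⊆)
  ... | inj₂ (inj₁ (ab⊆ , c′⊆)) with ∈-++⁻ (range 1 c) (to∈ c′⊆)
  ...   | inj₁ c′∈ = <-asym a<c′ (<-≤-trans (proj₂ (∈-range⁻ c′∈)) (proj₁ (∈-range⁻ (to∈ ab⊆))))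
  ...   | inj₂ c′∈ =
    <-asym c′<b (<-≤-trans (proj₂ (∈-range⁻ (to∈ (Sublist.∷ˡ⁻ ab⊆)))) (proj₁ (∈-range⁻ c′∈)))
  no321 : ¬ Occurs Is321 (blockSwap c p r)
  no321 (a , b , c′ , s , c′<b , b<a) with triple-⊆-++ (range (suc c) p) s
  ... | inj₁ bc⊆ = <-asym c′<b (AllPairs-⊆ head↗ bc⊆)
  ... | inj₂ (inj₁ (ab⊆ , _)) = <-asym b<a (AllPairs-⊆ head↗ ab⊆)
  ... | inj₂ (inj₂ bc⊆) = <-asym c′<b (AllPairs-⊆ tail↗ bc⊆)

interval⇒range : ∀ {a xs} → Increasing (a ∷ xs) →
  (∀ {y z} → y ∈ xs → a < z → z < y → z ∈ xs) → a ∷ xs ≡ range a (suc (length xs))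
interval⇒range {a} {[]} _ _ = refl
interval⇒range {a} {y ∷ ys} ((a<y ∷ _) ∷ y↗@(y<ys ∷ _)) closed with m≤n⇒m<n∨m≡n a<y
... | inj₁ 1+a<y with closed (here refl) (n<1+n a) 1+a<y
...   | here 1+a≡y = contradiction 1+a<y (<-irrefl 1+a≡y)
...   | there 1+a∈ys = contradiction (All.lookup y<ys 1+a∈ys) (<-asym 1+a<y)
interval⇒range {a} {y ∷ ys} (_ ∷ y↗) closed | inj₂ refl = cong (a ∷_) (interval⇒range y↗ closed′)
  where
  closed′ : ∀ {y′ z} → y′ ∈ ys → suc a < z → z < y′ → z ∈ ys
  closed′ y′∈ 1+a<z z<y′ with closed (there y′∈) (<-trans (n<1+n a) 1+a<z) z<y′
  ... | here refl = contradiction 1+a<z (<-irrefl refl)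
  ... | there z∈ = z∈

-- w = A ++ 1 ∷ B: avoiding 321 forces A to increase, avoiding 132 forces 1 ∷ B to increase
-- and A to be an interval.
module Shape {n A B} (w↭ : A ++ 1 ∷ B ↭ range 1 (suc n)) (avoids : Avoids (A ++ 1 ∷ B)) where

  others↭ : A ++ B ↭ range 2 n
  others↭ = drop-∷ (↭-trans (↭-sym (shift 1 A B)) w↭)

  others-bounds : ∀ {z} → z ∈ A ++ B → 2 ≤ z × z ≤ suc n
  others-bounds z∈ with ∈-range⁻ (∈-resp-↭ others↭ z∈)
  ... | 2≤z , z<2+n = 2≤z , ≤-pred z<2+n

  A-bounds : ∀ {z} → z ∈ A → 2 ≤ z × z ≤ suc n
  A-bounds = others-bounds ∘ ∈-++⁺ˡ

  B-bounds : ∀ {z} → z ∈ B → 2 ≤ z × z ≤ suc n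
  B-bounds = others-bounds ∘ ∈-++⁺ʳ A

  others-complete : ∀ {z} → 2 ≤ z → z ≤ suc n → z ∈ A ++ B
  others-complete 2≤z z≤1+n = ∈-resp-↭ (↭-sym others↭) (∈-range⁺ 2≤z (s≤s z≤1+n))

  others-distinct : ∀ {x y} → (x ∷ y ∷ []) ⊆ A ++ B → x ≢ y
  others-distinct =
    AllPairs-⊆ (unique-resp-↭ (↭-sym others↭) (increasing⇒unique (range-increasing 2 n)))

  A-increasing : Increasing A
  A-increasing = AllPairs-fromPairs λ {x} {y} xy⊆ → case-split xy⊆ (<-cmp x y)
    where
    case-split : ∀ {x y} → (x ∷ y ∷ []) ⊆ A → Tri (x < y) (x ≡ y) (y < x) → x < y
    case-split _ (tri< x<y _ _) = x<y
    case-split xy⊆ (tri≈ _ x≡y _) = contradiction x≡y (others-distinct (Sublist.++⁺ʳ B xy⊆))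
    case-split {x} {y} xy⊆ (tri> _ _ y<x) = ⊥-elim (proj₂ avoids
      (x , y , 1 , Sublist.++⁺ xy⊆ (from∈ (here refl)) , proj₁ (A-bounds (to∈ (Sublist.∷ˡ⁻ xy⊆))) , y<x))

  1∷B-increasing : Increasing (1 ∷ B)
  1∷B-increasing =
    All.tabulate (proj₁ ∘ B-bounds) ∷
    AllPairs-fromPairs λ {x} {y} xy⊆ → case-split xy⊆ (<-cmp x y)
    where
    case-split : ∀ {x y} → (x ∷ y ∷ []) ⊆ B → Tri (x < y) (x ≡ y) (y < x) → x < y
    case-split _ (tri< x<y _ _) = x<y
    case-split xy⊆ (tri≈ _ x≡y _) = contradiction x≡y (others-distinct (Sublist.++⁺ˡ A xy⊆))
    case-split {x} {y} xy⊆ (tri> _ _ y<x) = ⊥-elim (proj₁ avoids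
      (1 , x , y , Sublist.++⁺ˡ A (refl ∷ xy⊆) , proj₁ (B-bounds (to∈ (Sublist.∷ˡ⁻ xy⊆))) , y<x))

  A-interval : ∀ {m A′} → A ≡ m ∷ A′ → ∀ {y z} → y ∈ A′ → m < z → z < y → z ∈ A′
  A-interval refl {y} {z} y∈ m<z z<y
    with ∈-++⁻ A (others-complete (<-≤-trans (proj₁ (A-bounds (here refl))) (<⇒≤ m<z))
                                  (≤-trans (<⇒≤ z<y) (proj₂ (A-bounds (there y∈)))))
  ... | inj₁ (here refl) = contradiction m<z (<-irrefl refl)
  ... | inj₁ (there z∈) = z∈
  ... | inj₂ z∈B = ⊥-elim (proj₁ avoids
    (_ , y , z , Sublist.++⁺ (refl ∷ from∈ y∈) (1 ∷ʳ from∈ z∈B) , m<z , z<y))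

  A-range : ∃₂ λ c p → A ≡ range (suc c) p × c + p ≤ suc n
  A-range = from-head A refl
    where
    from-head : ∀ A′ → A ≡ A′ → ∃₂ λ c p → A ≡ range (suc c) p × c + p ≤ suc n
    from-head [] A≡ = 0 , 0 , A≡ , z≤n
    from-head (m ∷ A′) A≡ with A-bounds (subst (m ∈_) (sym A≡) (here refl))
    ... | s≤s {n = c} _ , _ = c , suc (length A′) , A≡range , last-bound
      where
      A≡range : A ≡ range (suc c) (suc (length A′))
      A≡range = trans A≡ (interval⇒range (subst Increasing A≡ A-increasing) (A-interval A≡))
      last-bound : c + suc (length A′) ≤ suc n
      last-bound = subst (_≤ suc n) (sym (+-suc c (length A′)))
        (proj₂ (A-bounds (subst (_ ∈_) (sym A≡range) (∈-range-last (suc c) (length A′)))))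

  shape : ∃₂ λ c p → ∃ λ r → c + p + r ≡ suc n × A ++ 1 ∷ B ≡ blockSwap c p r
  shape with A-range
  ... | c , p , refl , c+p≤ = c , p , r , total , cong (range (suc c) p ++_) 1∷B≡tail
    where
    r : ℕ
    r = suc n ∸ (c + p)
    total : c + p + r ≡ suc n
    total = m+[n∸m]≡n c+p≤
    1∷B≡tail : 1 ∷ B ≡ range 1 c ++ range (suc (c + p)) r
    1∷B≡tail = increasing-↭⇒≡ 1∷B-increasing (blockSwap-tail-increasing c p r)
      (++-cancelˡ-↭ (range (suc c) p)
        (↭-trans w↭ (↭-sym (subst (λ k → blockSwap c p r ↭ range 1 k) total (blockSwap-↭ c p r)))))

avoider-shape : ∀ n {w} → w ↭ range 1 n → Avoids w →
  ∃₂ λ c p → ∃ λ r → c + p + r ≡ n × w ≡ blockSwap c p r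
avoider-shape zero w↭ _ = 0 , 0 , 0 , refl , ↭-empty-inv w↭
avoider-shape (suc n) w↭ avoids with ∈-∃++ (∈-resp-↭ (↭-sym w↭) (here refl))
... | A , B , refl = Shape.shape w↭ avoids

des-increasing : ∀ {w} → Increasing w → des w ≡ 0
des-increasing [] = refl
des-increasing (_ ∷ []) = refl
des-increasing {x ∷ y ∷ _} ((x<y ∷ _) ∷ y↗) rewrite <ᵇ-false {y} {x} (<⇒≤ x<y) = des-increasing y↗

des-range-++-smaller : ∀ a k {y ys} → y < a → Increasing (y ∷ ys) → des (range a (suc k) ++ y ∷ ys) ≡ 1
des-range-++-smaller a zero y<a y↗ rewrite <ᵇ-true y<a = cong suc (des-increasing y↗)
des-range-++-smaller a (suc k) y<a y↗ rewrite <ᵇ-false {suc a} {a} (n≤1+n a) =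
  des-range-++-smaller (suc a) k (<-trans y<a (n<1+n a)) y↗

des-blockSwap : ∀ {c p} r → 1 ≤ c → 1 ≤ p → des (blockSwap c p r) ≡ 1
des-blockSwap {suc c} {suc p} r _ _ =
  des-range-++-smaller (suc (suc c)) p (s≤s z<s) (blockSwap-tail-increasing (suc c) (suc p) r)

-- Diamonds

blockOK-increasing : ∀ {a rest} → Increasing (a ∷ rest) → rest ≢ [] → T (blockOK (a ∷ rest))
blockOK-increasing {a} {rest} a↗ rest≢[] with initLast rest
... | [] = rest≢[] refl
... | ms ∷ʳ′ c = Equivalence.from T-∧
  ( T-all⁺ (a <ᵇ_) {ms} (λ m∈ → <⇒<ᵇ (All.lookup (AllPairs.head a↗) (∈-++⁺ˡ m∈)))
  , T-all⁺ (_<ᵇ c) {ms} λ m∈ →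
      <⇒<ᵇ (AllPairs-⊆ (AllPairs.tail a↗) (Sublist.++⁺ (from∈ m∈) (refl ∷ []))))

blockOK-least : ∀ {a rest x} → T (blockOK (a ∷ rest)) → 2 ≤ length rest → x ∈ rest → a < x
blockOK-least {a} {rest} ok len x∈ with initLast rest
... | [] = contradiction len λ ()
... | ms ∷ʳ′ c with Equivalence.to T-∧ ok | ∈-++⁻ ms x∈
...   | a<ms , _ | inj₁ x∈ms = <ᵇ⇒< a _ (T-all⁻ (a <ᵇ_) {ms} a<ms x∈ms)
...   | a<ms , ms<c | inj₂ (here refl) with ms
...     | [] = contradiction len (λ { (s≤s ()) })
...     | m ∷ ms′ = <-trans (<ᵇ⇒< a m (T-all⁻ (a <ᵇ_) {m ∷ ms′} a<ms (here refl)))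
                            (<ᵇ⇒< m c (T-all⁻ (_<ᵇ c) {m ∷ ms′} ms<c (here refl)))

take-++ˡ : ∀ {A : Set} n (X Y : List A) → n ≤ length X → take n (X ++ Y) ≡ take n X
take-++ˡ zero X Y _ = refl
take-++ˡ (suc n) (x ∷ X) Y (s≤s n≤) = cong (x ∷_) (take-++ˡ n X Y n≤)

drop-++ˡ : ∀ {A : Set} n (X Y : List A) → n ≤ length X → drop n (X ++ Y) ≡ drop n X ++ Y
drop-++ˡ zero X Y _ = refl
drop-++ˡ (suc n) (x ∷ X) Y (s≤s n≤) = drop-++ˡ n X Y n≤

∈-take-++ : ∀ {A : Set} n (X : List A) {x Y} → length X < n → x ∈ take n (X ++ x ∷ Y)
∈-take-++ (suc n) [] _ = here refl
∈-take-++ (suc n) (_ ∷ X) (s≤s len<) = there (∈-take-++ n X len<)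

drop-range : ∀ a k l → drop k (range a (k + l)) ≡ range (a + k) l
drop-range a zero l = cong (λ b → range b l) (sym (+-identityʳ a))
drop-range a (suc k) l = trans (drop-range (suc a) k l) (cong (λ b → range b l) (sym (+-suc a k)))

FirstBlockOK : ℕ → ℕ → List ℕ → Set
FirstBlockOK v d w = length (take v w) ≡ v × T (blockOK (take v w)) × T (diamondsOK v d (drop v w))

T-diamondsOK-suc : ∀ v d w → T (diamondsOK v (suc d) w) ⇔ FirstBlockOK v d w
T-diamondsOK-suc v d w = mk⇔ to from
  where
  to : T (diamondsOK v (suc d) w) → FirstBlockOK v d w
  to ok with Equivalence.to T-∧ ok
  ... | len , rest with Equivalence.to T-∧ rest
  ...   | block , blocks = ≡ᵇ⇒≡ _ _ len , block , blocks
  from : FirstBlockOK v d w → T (diamondsOK v (suc d) w)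
  from (len , block , blocks) =
    Equivalence.from T-∧ (≡⇒≡ᵇ _ _ len , Equivalence.from T-∧ (block , blocks))

diamondsOK-increasing : ∀ {v} d {w} → 2 ≤ v → Increasing w → length w ≡ d * v → T (diamondsOK v d w)
diamondsOK-increasing zero {[]} _ _ _ = _
diamondsOK-increasing {v} (suc d) {w} 2≤v w↗ len =
  Equivalence.from (T-diamondsOK-suc v d w)
    (length-first , first-block (AllPairs.take⁺ v w↗) length-first , rest)
  where
  length-first : length (take v w) ≡ v
  length-first = trans (List.length-take v w) (m≤n⇒m⊓n≡m (subst (v ≤_) (sym len) (m≤m+n v (d * v))))
  first-block : ∀ {b} → Increasing b → length b ≡ v → T (blockOK b)
  first-block {_ ∷ _ ∷ _} b↗ _ = blockOK-increasing b↗ λ ()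
  first-block {[]} _ refl = contradiction 2≤v λ ()
  first-block {_ ∷ []} _ refl = contradiction 2≤v λ { (s≤s ()) }
  rest : T (diamondsOK v d (drop v w))
  rest = diamondsOK-increasing d 2≤v (AllPairs.drop⁺ v w↗)
    (trans (List.length-drop v w) (trans (cong (_∸ v) len) (m+n∸m≡n v (d * v))))

diamondsOK-++ : ∀ {v} k {e X Y} → T (diamondsOK v k X) → T (diamondsOK v e Y) → length X ≡ k * v →
  T (diamondsOK v (k + e) (X ++ Y))
diamondsOK-++ zero {X = []} _ okY _ = okY
diamondsOK-++ {v} (suc k) {e} {X} {Y} okX okY len with Equivalence.to (T-diamondsOK-suc v k X) okX
... | length-first , block , blocks = Equivalence.from (T-diamondsOK-suc v (k + e) (X ++ Y))
  ( trans (cong length take≡) length-first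
  , subst (T ∘ blockOK) (sym take≡) block
  , subst (T ∘ diamondsOK v (k + e)) (sym drop≡) (diamondsOK-++ k blocks okY length-rest))
  where
  v≤ : v ≤ length X
  v≤ = subst (v ≤_) (sym len) (m≤m+n v (k * v))
  take≡ : take v (X ++ Y) ≡ take v X
  take≡ = take-++ˡ v X Y v≤
  drop≡ : drop v (X ++ Y) ≡ drop v X ++ Y
  drop≡ = drop-++ˡ v X Y v≤
  length-rest : length (drop v X) ≡ k * v
  length-rest = trans (List.length-drop v X) (trans (cong (_∸ v) len) (m+n∸m≡n v (k * v)))

-- A diamond cannot contain 1 above a larger least element, so 1 starts a new diamond.
diamondsOK-range⇒∣ : ∀ {v} D {a p ys} → 3 ≤ v → 2 ≤ a → T (diamondsOK v D (range a p ++ 1 ∷ ys)) → v ∣ p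
diamondsOK-range⇒∣ zero {p = zero} _ _ ()
diamondsOK-range⇒∣ zero {p = suc _} _ _ ()
diamondsOK-range⇒∣ {v} (suc D) {a} {p} {ys} 3≤v 2≤a ok
  with v ≤? p | Equivalence.to (T-diamondsOK-suc v D (range a p ++ 1 ∷ ys)) ok
... | yes v≤p | _ , _ , blocks =
  ∣m∸n∣n⇒∣m v v≤p (diamondsOK-range⇒∣ D 3≤v (≤-trans 2≤a (m≤m+n a v)) blocks′) ∣-refl
  where
  blocks′ : T (diamondsOK v D (range (a + v) (p ∸ v) ++ 1 ∷ ys))
  blocks′ = subst (T ∘ diamondsOK v D) drop≡ blocks
    where
    p≡ : p ≡ v + (p ∸ v)
    p≡ = sym (m+[n∸m]≡n v≤p)
    drop≡ : drop v (range a p ++ 1 ∷ ys) ≡ range (a + v) (p ∸ v) ++ 1 ∷ ys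
    drop≡ = trans (drop-++ˡ v (range a p) _ (subst (v ≤_) (sym (length-range a p)) v≤p))
                  (cong (_++ 1 ∷ ys) (trans (cong (λ k → drop v (range a k)) p≡) (drop-range a v (p ∸ v))))
... | no _ | _ with p
...   | zero = v ∣0
diamondsOK-range⇒∣ {suc v′} (suc D) {a} {ys = ys} 3≤v 2≤a ok | no p≮v | length-first , block , _ | suc p′ =
  contradiction (blockOK-least block 2≤v′ 1∈) (<⇒≱ 2≤a ∘ <⇒≤)
  where
  2≤v′ : 2 ≤ length (take v′ (range (suc a) p′ ++ 1 ∷ ys))
  2≤v′ = subst (2 ≤_) (sym (suc-injective length-first)) (≤-pred 3≤v)
  1∈ : 1 ∈ take v′ (range (suc a) p′ ++ 1 ∷ ys)
  1∈ = ∈-take-++ v′ (range (suc a) p′) (subst (_< v′) (sym (length-range (suc a) p′)) (≤-pred (≰⇒> p≮v)))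

-- Counting labelled diamonds by descents

avoider-cases : ∀ {n w} → w ↭ range 1 n → Avoids w →
  w ≡ range 1 n ⊎ ∃₂ λ c p → ∃ λ r → 1 ≤ c × 1 ≤ p × c + p + r ≡ n × w ≡ blockSwap c p r
avoider-cases {n} w↭ avoids with avoider-shape n w↭ avoids
... | zero , p , r , refl , refl = inj₁ (blockSwap-degenerate r (inj₁ refl))
... | c , zero , r , refl , refl = inj₁ (blockSwap-degenerate r (inj₂ refl))
... | suc c , suc p , r , total , refl = inj₂ (suc c , suc p , r , s≤s z≤n , s≤s z≤n , total , refl)

Good : ℕ → ℕ → ℕ → List ℕ → Set
Good v D i w = w ↭ range 1 (v * D) × T (diamondsOK v D w) × Avoids w × des w ≡ i

countD≡length : ∀ v D {i L} → Unique L → (∀ {w} → Good v D i w ⇔ w ∈ L) → countD v D i ≡ length L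
countD≡length v D {i} {L} L! good⇔ =
  ↭-length (∼bag⇒↭ (unique∧set⇒bag counted! L!
    (mk⇔ (Equivalence.to good⇔ ∘ counted⇒good) (counted⇐good ∘ Equivalence.from good⇔))))
  where
  Q : List ℕ → Bool
  Q w = avoidsAll (p132 ∷ p321 ∷ []) w ∧ (des w ≡ᵇ i)
  counted! : Unique (filterᵇ Q (diamondWords v D))
  counted! = Unique.filter⁺ (T? ∘ Q) (Unique.filter⁺ (T? ∘ diamondsOK v D) (permutations-unique
    (subst Unique (sym (labels≡range (v * D))) (increasing⇒unique (range-increasing 1 (v * D))))))
  counted⇒good : ∀ {w} → w ∈ filterᵇ Q (diamondWords v D) → Good v D i w
  counted⇒good w∈ with ∈-filter⁻ (T? ∘ Q) w∈
  ... | w∈′ , q with ∈-filter⁻ (T? ∘ diamondsOK v D) w∈′ | Equivalence.to T-∧ q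
  ...   | w∈″ , ok | av , d =
    subst (_ ↭_) (labels≡range (v * D)) (∈-permutations⁻ w∈″) , ok ,
    Equivalence.to (avoidsAll⇔Avoids _) av , ≡ᵇ⇒≡ _ _ d
  counted⇐good : ∀ {w} → Good v D i w → w ∈ filterᵇ Q (diamondWords v D)
  counted⇐good {w} (w↭ , ok , avoids , des≡) = ∈-filter⁺ (T? ∘ Q)
    (∈-filter⁺ (T? ∘ diamondsOK v D)
      (∈-permutations⁺ _ (subst (w ↭_) (sym (labels≡range (v * D))) w↭)) ok)
    (Equivalence.from T-∧ (Equivalence.from (avoidsAll⇔Avoids w) avoids , ≡⇒≡ᵇ _ _ des≡))

identity-good : ∀ {v} D → 2 ≤ v → Good v D 0 (range 1 (v * D))
identity-good {v} D 2≤v =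
  ↭-refl ,
  diamondsOK-increasing D 2≤v (range-increasing 1 (v * D)) (trans (length-range 1 (v * D)) (*-comm v D)) ,
  blockSwap-avoids 0 0 (v * D) ,
  des-increasing (range-increasing 1 (v * D))

count-noDescent : ∀ {v} D → 2 ≤ v → countD v D 0 ≡ 1
count-noDescent {v} D 2≤v = countD≡length v D ([] ∷ []) (mk⇔ to from)
  where
  to : ∀ {w} → Good v D 0 w → w ∈ range 1 (v * D) ∷ []
  to (w↭ , _ , avoids , des≡) with avoider-cases w↭ avoids
  ... | inj₁ refl = here refl
  ... | inj₂ (_ , _ , r , 1≤c , 1≤p , _ , refl) =
    contradiction (trans (sym des≡) (des-blockSwap r 1≤c 1≤p)) λ ()
  from : ∀ {w} → w ∈ range 1 (v * D) ∷ [] → Good v D 0 w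
  from (here refl) = identity-good D 2≤v

count-manyDescents : ∀ v D i → countD v D (suc (suc i)) ≡ 0
count-manyDescents v D i = countD≡length v D [] (mk⇔ (⊥-elim ∘ impossible) λ ())
  where
  impossible : ∀ {w} → ¬ Good v D (suc (suc i)) w
  impossible (w↭ , _ , avoids , des≡) with avoider-cases w↭ avoids
  ... | inj₁ refl = contradiction (trans (sym des≡) (des-increasing (range-increasing 1 (v * D)))) λ ()
  ... | inj₂ (_ , _ , r , 1≤c , 1≤p , _ , refl) =
    contradiction (trans (sym des≡) (des-blockSwap r 1≤c 1≤p)) λ ()

blockSwap-injectiveˡ : ∀ {c c′ p p′ r r′} → 1 ≤ p → 1 ≤ p′ → blockSwap c p r ≡ blockSwap c′ p′ r′ → c ≡ c′
blockSwap-injectiveˡ {p = suc _} {suc _} _ _ eq = suc-injective (List.∷-injectiveˡ eq)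

blockSwap-injectiveʳ : ∀ {c p p′ r r′} → 1 ≤ c → blockSwap c p r ≡ blockSwap c p′ r′ → p ≡ p′
blockSwap-injectiveʳ {suc c} {p} {p′} _ eq =
  trans (sym (length-range _ p))
    (trans (cong length (proj₁ (++-∷-injective (range (suc (suc c)) p) (range (suc (suc c)) p′) 1∉ 1∉ eq)))
      (length-range _ p′))
  where
  1∉ : ∀ {k} → 1 ∉ range (suc (suc c)) k
  1∉ 1∈ = contradiction (proj₁ (∈-range⁻ 1∈)) λ { (s≤s ()) }

swapWord : ℕ → ℕ → ℕ → ℕ → List ℕ
swapWord v D j c = blockSwap c ((D ∸ j) * v) (j * v ∸ c)

swapWords : ℕ → ℕ → ℕ → List (List ℕ)
swapWords v D zero = []
swapWords v D (suc j) = map (swapWord v D (suc j)) (range 1 (suc j * v)) ++ swapWords v D j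

IsSwapWord : ℕ → ℕ → ℕ → List ℕ → Set
IsSwapWord v D k w = ∃₂ λ j c → 1 ≤ j × j ≤ k × 1 ≤ c × c ≤ j * v × w ≡ swapWord v D j c

∈-swapWords⁻ : ∀ {v D} k {w} → w ∈ swapWords v D k → IsSwapWord v D k w
∈-swapWords⁻ {v} {D} (suc k) w∈ with ∈-++⁻ (map (swapWord v D (suc k)) (range 1 (suc k * v))) w∈
... | inj₁ w∈′ with ∈-map⁻ (swapWord v D (suc k)) w∈′
...   | c , c∈ , refl = suc k , c , s≤s z≤n , ≤-refl , proj₁ (∈-range⁻ c∈) , ≤-pred (proj₂ (∈-range⁻ c∈)) , refl
∈-swapWords⁻ (suc k) w∈ | inj₂ w∈′ with ∈-swapWords⁻ k w∈′
...   | j , c , 1≤j , j≤k , rest = j , c , 1≤j , m≤n⇒m≤1+n j≤k , rest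

∈-swapWords⁺ : ∀ {v D} k {j c} → 1 ≤ j → j ≤ k → 1 ≤ c → c ≤ j * v → swapWord v D j c ∈ swapWords v D k
∈-swapWords⁺ zero (s≤s _) ()
∈-swapWords⁺ {v} {D} (suc k) 1≤j j≤1+k 1≤c c≤ with m≤n⇒m<n∨m≡n j≤1+k
... | inj₂ refl = ∈-++⁺ˡ (∈-map⁺ (swapWord v D (suc k)) (∈-range⁺ 1≤c (s≤s c≤)))
... | inj₁ j<1+k = ∈-++⁺ʳ _ (∈-swapWords⁺ k 1≤j (≤-pred j<1+k) 1≤c c≤)

length-swapWords : ∀ v D k → length (swapWords v D k) ≡ (suc k C 2) * v
length-swapWords v D zero = refl
length-swapWords v D (suc k) = begin
  length (map (swapWord v D (suc k)) (range 1 (suc k * v)) ++ swapWords v D k)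
    ≡⟨ List.length-++ (map (swapWord v D (suc k)) (range 1 (suc k * v))) ⟩
  length (map (swapWord v D (suc k)) (range 1 (suc k * v))) + length (swapWords v D k)
    ≡⟨ cong₂ _+_ (trans (List.length-map (swapWord v D (suc k)) (range 1 (suc k * v))) (length-range 1 (suc k * v)))
                 (length-swapWords v D k) ⟩
  suc k * v + (suc k C 2) * v
    ≡⟨ cong (λ m → m * v + (suc k C 2) * v) (nC1≡n (suc k)) ⟨
  (suc k C 1) * v + (suc k C 2) * v
    ≡⟨ *-distribʳ-+ v (suc k C 1) (suc k C 2) ⟨
  (suc k C 1 + suc k C 2) * v
    ≡⟨ cong (_* v) (nCk+nC[k+1]≡[n+1]C[k+1] (suc k) 1) ⟩
  (suc (suc k) C 2) * v ∎
  where open ≡-Reasoning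

first-run-positive : ∀ {v D j} → 1 ≤ v → j < D → 1 ≤ (D ∸ j) * v
first-run-positive {v} 1≤v j<D = *-mono-≤ (m<n⇒0<n∸m j<D) 1≤v

swapWords-unique : ∀ {v D} k → 1 ≤ v → k < D → Unique (swapWords v D k)
swapWords-unique zero _ _ = []
swapWords-unique {v} {D} (suc k) 1≤v k<D =
  Unique.++⁺ (Unique.map⁺ (blockSwap-injectiveˡ run>0 run>0) (increasing⇒unique (range-increasing 1 _)))
    (swapWords-unique k 1≤v (<-trans (n<1+n k) k<D)) disjoint
  where
  run>0 : 1 ≤ (D ∸ suc k) * v
  run>0 = first-run-positive 1≤v k<D
  disjoint : ∀ {w} → ¬ (w ∈ map (swapWord v D (suc k)) (range 1 (suc k * v)) × w ∈ swapWords v D k)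
  disjoint (w∈ , w∈′) with ∈-map⁻ (swapWord v D (suc k)) w∈ | ∈-swapWords⁻ k w∈′
  ... | c , c∈ , refl | j , c′ , _ , j≤k , _ , _ , eq
    with blockSwap-injectiveˡ run>0 (first-run-positive 1≤v (≤-<-trans j≤k (<-trans (n<1+n k) k<D))) eq
  ... | refl = 1+n≰n (subst (_≤ k) (sym 1+k≡j) j≤k)
    where
    runs≡ : D ∸ suc k ≡ D ∸ j
    runs≡ = *-cancelʳ-≡ _ _ v {{>-nonZero 1≤v}} (blockSwap-injectiveʳ (proj₁ (∈-range⁻ c∈)) eq)
    1+k≡j : suc k ≡ j
    1+k≡j = ∸-cancelˡ-≡ (<⇒≤ k<D) (≤-trans (m≤n⇒m≤1+n j≤k) (<⇒≤ k<D)) runs≡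

tail-diamonds : ∀ {v D c p r q} → 1 ≤ c → 1 ≤ p → c + p + r ≡ v * D → p ≡ q * v →
  ∃ λ j → 1 ≤ j × j < D × c ≤ j * v × (D ∸ j) * v ≡ p × j * v ∸ c ≡ r
tail-diamonds {v} {D} {c} {p} {r} {q} 1≤c 1≤p total p≡ =
  D ∸ q , m<n⇒0<n∸m q<D , ∸-monoʳ-< 1≤q (<⇒≤ q<D) , c≤tail , first-run ,
  trans (cong (_∸ c) tail≡) (m+n∸m≡n c r)
  where
  1≤q : 1 ≤ q
  1≤q = n≢0⇒n>0 λ q≡0 → <⇒≢ 1≤p (sym (trans p≡ (cong (_* v) q≡0)))
  q<D : q < D
  q<D = *-cancelʳ-< v q D (begin-strict
    q * v     ≡⟨ p≡ ⟨
    p         <⟨ m<n+m p 1≤c ⟩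
    c + p     ≤⟨ m≤m+n (c + p) r ⟩
    c + p + r ≡⟨ trans total (*-comm v D) ⟩
    D * v     ∎)
    where open ≤-Reasoning
  first-run : (D ∸ (D ∸ q)) * v ≡ p
  first-run = trans (cong (_* v) (m∸[m∸n]≡n (<⇒≤ q<D))) (sym p≡)
  tail≡ : (D ∸ q) * v ≡ c + r
  tail≡ = begin
    (D ∸ q) * v     ≡⟨ *-distribʳ-∸ v D q ⟩
    D * v ∸ q * v   ≡⟨ cong₂ _∸_ (trans (*-comm D v) (sym total)) (sym p≡) ⟩
    c + p + r ∸ p   ≡⟨ cong (_∸ p) (trans (cong (_+ r) (+-comm c p)) (+-assoc p c r)) ⟩
    p + (c + r) ∸ p ≡⟨ m+n∸m≡n p (c + r) ⟩
    c + r           ∎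
    where open ≡-Reasoning
  c≤tail : c ≤ (D ∸ q) * v
  c≤tail = subst (c ≤_) (sym tail≡) (m≤m+n c r)

swapWord-good : ∀ {v d j c} → 2 ≤ v → 1 ≤ j → j ≤ d → 1 ≤ c → c ≤ j * v →
  Good v (suc d) 1 (swapWord v (suc d) j c)
swapWord-good {v} {d} {j} {c} 2≤v 1≤j j≤d 1≤c c≤ =
  subst (λ n → blockSwap c p r ↭ range 1 n) total (blockSwap-↭ c p r) ,
  subst (λ k → T (diamondsOK v k (blockSwap c p r))) (m∸n+n≡m j≤D)
    (diamondsOK-++ (D ∸ j)
      (diamondsOK-increasing (D ∸ j) 2≤v (range-increasing (suc c) p) (length-range (suc c) p))
      (diamondsOK-increasing j 2≤v (blockSwap-tail-increasing c p r) tail-length)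
      (length-range (suc c) p)) ,
  blockSwap-avoids c p r ,
  des-blockSwap r 1≤c (first-run-positive (≤-trans (s≤s z≤n) 2≤v) (s≤s j≤d))
  where
  D p r : ℕ
  D = suc d
  p = (D ∸ j) * v
  r = j * v ∸ c
  j≤D : j ≤ D
  j≤D = m≤n⇒m≤1+n j≤d
  c+r : c + r ≡ j * v
  c+r = m+[n∸m]≡n c≤
  tail-length : length (range 1 c ++ range (suc (c + p)) r) ≡ j * v
  tail-length =
    trans (List.length-++ (range 1 c)) (trans (cong₂ _+_ (length-range 1 c) (length-range _ r)) c+r)
  open ≡-Reasoning
  total : c + p + r ≡ v * D
  total = begin
    c + p + r         ≡⟨ cong (_+ r) (+-comm c p) ⟩
    p + c + r         ≡⟨ +-assoc p c r ⟩
    p + (c + r)       ≡⟨ cong (λ x → p + x) c+r ⟩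
    p + j * v         ≡⟨ *-distribʳ-+ v (D ∸ j) j ⟨
    (D ∸ j + j) * v   ≡⟨ cong (_* v) (m∸n+n≡m j≤D) ⟩
    D * v             ≡⟨ *-comm D v ⟩
    v * D             ∎

oneDescent-good⇔ : ∀ {v} d {w} → 3 ≤ v → Good v (suc d) 1 w ⇔ w ∈ swapWords v (suc d) d
oneDescent-good⇔ {v} d 3≤v = mk⇔ to from
  where
  to : ∀ {w} → Good v (suc d) 1 w → w ∈ swapWords v (suc d) d
  to (w↭ , ok , avoids , des≡) with avoider-cases w↭ avoids
  ... | inj₁ refl = contradiction (trans (sym des≡) (des-increasing (range-increasing 1 (v * suc d)))) λ ()
  ... | inj₂ (suc c , p , r , 1≤c , 1≤p , total , refl)
    with diamondsOK-range⇒∣ (suc d) 3≤v (s≤s (s≤s z≤n)) ok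
  ... | divides q p≡ with tail-diamonds {q = q} 1≤c 1≤p total p≡
  ... | j , 1≤j , j<D , c≤ , first-run , tail =
    subst (_∈ swapWords v (suc d) d) (cong₂ (blockSwap (suc c)) first-run tail)
      (∈-swapWords⁺ d 1≤j (≤-pred j<D) 1≤c c≤)
  from : ∀ {w} → w ∈ swapWords v (suc d) d → Good v (suc d) 1 w
  from w∈ with ∈-swapWords⁻ d w∈
  ... | j , c , 1≤j , j≤d , 1≤c , c≤ , refl = swapWord-good (≤-trans (n≤1+n 2) 3≤v) 1≤j j≤d 1≤c c≤

count-oneDescent : ∀ {v} d → 3 ≤ v → countD v (suc d) 1 ≡ (suc d C 2) * v
count-oneDescent {v} d 3≤v =
  trans (countD≡length v (suc d) (swapWords-unique d (≤-trans (s≤s z≤n) 3≤v) ≤-refl)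
                       (oneDescent-good⇔ d 3≤v))
        (length-swapWords v (suc d) d)

-- Power series

Σ≤-suc : ∀ n (f : ℕ → ℤ) → Σ≤ (suc n) f ≡ f 0 ℤ.+ Σ≤ n (f ∘ suc)
Σ≤-suc n f = cong (λ xs → f 0 ℤ.+ foldr ℤ._+_ (+ 0) xs)
  (trans (List.map-applyUpTo suc f (suc n)) (sym (List.map-applyUpTo (λ j → j) (f ∘ suc) (suc n))))

Σ≤-cong : ∀ n {f g : ℕ → ℤ} → (∀ j → f j ≡ g j) → Σ≤ n f ≡ Σ≤ n g
Σ≤-cong n f≗g = cong (foldr ℤ._+_ (+ 0)) (List.map-cong f≗g (upTo (suc n)))

Σ≤-zero : ∀ n → Σ≤ n (λ _ → + 0) ≡ + 0
Σ≤-zero zero = refl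
Σ≤-zero (suc n) = trans (Σ≤-suc n (λ _ → + 0)) (trans (ℤ.+-identityˡ _) (Σ≤-zero n))

-- (a *ₛ b) d i is Σ≤ d (λ j → (a j ⋆ b (d ∸ j)) i) by definition.
_⋆_ : (ℕ → ℤ) → (ℕ → ℤ) → ℕ → ℤ
(f ⋆ g) n = Σ≤ n (λ k → f k ℤ.* g (n ∸ k))

⋆-constantʳ : ∀ n (f g : ℕ → ℤ) → (∀ t → g (suc t) ≡ + 0) → (f ⋆ g) n ≡ f n ℤ.* g 0
⋆-constantʳ zero f g _ = ℤ.+-identityʳ (f 0 ℤ.* g 0)
⋆-constantʳ (suc n) f g g0 = begin
  (f ⋆ g) (suc n)                         ≡⟨ Σ≤-suc n (λ k → f k ℤ.* g (suc n ∸ k)) ⟩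
  f 0 ℤ.* g (suc n) ℤ.+ ((f ∘ suc) ⋆ g) n ≡⟨ cong (λ x → f 0 ℤ.* x ℤ.+ ((f ∘ suc) ⋆ g) n) (g0 n) ⟩
  f 0 ℤ.* + 0 ℤ.+ ((f ∘ suc) ⋆ g) n       ≡⟨ cong (ℤ._+ ((f ∘ suc) ⋆ g) n) (ℤ.*-zeroʳ (f 0)) ⟩
  + 0 ℤ.+ ((f ∘ suc) ⋆ g) n               ≡⟨ ℤ.+-identityˡ _ ⟩
  ((f ∘ suc) ⋆ g) n                       ≡⟨ ⋆-constantʳ n (f ∘ suc) g g0 ⟩
  f (suc n) ℤ.* g 0                       ∎
  where open ≡-Reasoning

⋆-constantˡ : ∀ n (f g : ℕ → ℤ) → (∀ t → f (suc t) ≡ + 0) → (f ⋆ g) n ≡ f 0 ℤ.* g n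
⋆-constantˡ zero f g _ = ℤ.+-identityʳ (f 0 ℤ.* g 0)
⋆-constantˡ (suc n) f g f0 = begin
  (f ⋆ g) (suc n)
    ≡⟨ Σ≤-suc n (λ k → f k ℤ.* g (suc n ∸ k)) ⟩
  f 0 ℤ.* g (suc n) ℤ.+ Σ≤ n (λ k → f (suc k) ℤ.* g (n ∸ k))
    ≡⟨ cong (λ x → f 0 ℤ.* g (suc n) ℤ.+ x) (Σ≤-cong n λ k → cong (ℤ._* g (n ∸ k)) (f0 k)) ⟩
  f 0 ℤ.* g (suc n) ℤ.+ Σ≤ n (λ _ → + 0)
    ≡⟨ cong (λ x → f 0 ℤ.* g (suc n) ℤ.+ x) (Σ≤-zero n) ⟩
  f 0 ℤ.* g (suc n) ℤ.+ + 0
    ≡⟨ ℤ.+-identityʳ _ ⟩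
  f 0 ℤ.* g (suc n) ∎
  where open ≡-Reasoning

⋆-window : ∀ k m (u c : ℕ → ℤ) → (∀ e → k < e → c e ≡ + 0) →
  (u ⋆ c) (m + k) ≡ Σ≤ k (λ j → u (m + j) ℤ.* c (k ∸ j))
⋆-window k zero u c _ = refl
⋆-window k (suc m) u c c0 = begin
  (u ⋆ c) (suc m + k)
    ≡⟨ Σ≤-suc (m + k) (λ j → u j ℤ.* c (suc m + k ∸ j)) ⟩
  u 0 ℤ.* c (suc m + k) ℤ.+ ((u ∘ suc) ⋆ c) (m + k)
    ≡⟨ cong (λ x → u 0 ℤ.* x ℤ.+ ((u ∘ suc) ⋆ c) (m + k)) (c0 _ (s≤s (m≤n+m k m))) ⟩
  u 0 ℤ.* + 0 ℤ.+ ((u ∘ suc) ⋆ c) (m + k)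
    ≡⟨ cong (ℤ._+ ((u ∘ suc) ⋆ c) (m + k)) (ℤ.*-zeroʳ (u 0)) ⟩
  + 0 ℤ.+ ((u ∘ suc) ⋆ c) (m + k)
    ≡⟨ ℤ.+-identityˡ _ ⟩
  ((u ∘ suc) ⋆ c) (m + k)
    ≡⟨ ⋆-window k m (u ∘ suc) c c0 ⟩
  Σ≤ k (λ j → u (suc m + j) ℤ.* c (k ∸ j)) ∎
  where open ≡-Reasoning

XFree : Series₂ → Set
XFree s = ∀ d i → s d (suc i) ≡ + 0

YDegree≤ : ℕ → Series₂ → Set
YDegree≤ k s = ∀ d → k < d → ∀ i → s d i ≡ + 0

*ₛ-congˡ : ∀ {a a′ : Series₂} b → (∀ d i → a d i ≡ a′ d i) → ∀ d i → (a *ₛ b) d i ≡ (a′ *ₛ b) d i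
*ₛ-congˡ b a≗a′ d i = Σ≤-cong d λ j → Σ≤-cong i λ k → cong (ℤ._* b (d ∸ j) (i ∸ k)) (a≗a′ j k)

*ₛ-xFree : ∀ {b} → XFree b → ∀ a d i → (a *ₛ b) d i ≡ Σ≤ d (λ j → a j i ℤ.* b (d ∸ j) 0)
*ₛ-xFree {b} xb a d i = Σ≤-cong d λ j → ⋆-constantʳ i (a j) (b (d ∸ j)) (xb (d ∸ j))

oneMinusY-xFree : XFree oneMinusY
oneMinusY-xFree zero i = refl
oneMinusY-xFree (suc zero) i = refl
oneMinusY-xFree (suc (suc d)) i = refl

oneMinusY-yDegree : YDegree≤ 1 oneMinusY
oneMinusY-yDegree (suc zero) (s≤s ()) i
oneMinusY-yDegree (suc (suc d)) _ i = refl

oneMinusY-*ₛ-zero : ∀ b i → (oneMinusY *ₛ b) 0 i ≡ b 0 i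
oneMinusY-*ₛ-zero b i = trans (ℤ.+-identityʳ _)
  (trans (⋆-constantˡ i (oneMinusY 0) (b 0) (oneMinusY-xFree 0)) (ℤ.*-identityˡ (b 0 i)))

oneMinusY-*ₛ-suc : ∀ b d i → (oneMinusY *ₛ b) (suc d) i ≡ b (suc d) i ℤ.- b d i
oneMinusY-*ₛ-suc b d i = begin
  (oneMinusY *ₛ b) (suc d) i
    ≡⟨ Σ≤-cong (suc d) (λ j → ⋆-constantˡ i (oneMinusY j) (b (suc d ∸ j)) (oneMinusY-xFree j)) ⟩
  Σ≤ (suc d) (λ j → oneMinusY j 0 ℤ.* b (suc d ∸ j) i)
    ≡⟨ Σ≤-suc d (λ j → oneMinusY j 0 ℤ.* b (suc d ∸ j) i) ⟩
  + 1 ℤ.* b (suc d) i ℤ.+ Σ≤ d (λ j → oneMinusY (suc j) 0 ℤ.* b (d ∸ j) i)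
    ≡⟨ cong₂ ℤ._+_ (ℤ.*-identityˡ (b (suc d) i)) (trans (later d) (ℤ.-1*i≡-i (b d i))) ⟩
  b (suc d) i ℤ.- b d i ∎
  where
  open ≡-Reasoning
  later : ∀ d → Σ≤ d (λ j → oneMinusY (suc j) 0 ℤ.* b (d ∸ j) i) ≡ - + 1 ℤ.* b d i
  later zero = ℤ.+-identityʳ _
  later (suc d) = trans (Σ≤-suc d (λ j → oneMinusY (suc j) 0 ℤ.* b (suc d ∸ j) i))
    (trans (cong (λ x → - + 1 ℤ.* b (suc d) i ℤ.+ x) (Σ≤-zero d)) (ℤ.+-identityʳ _))

oneMinusY-*ₛ-xFree : ∀ {b} → XFree b → XFree (oneMinusY *ₛ b)
oneMinusY-*ₛ-xFree {b} xb zero i = trans (oneMinusY-*ₛ-zero b (suc i)) (xb 0 i)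
oneMinusY-*ₛ-xFree {b} xb (suc d) i =
  trans (oneMinusY-*ₛ-suc b d (suc i)) (cong₂ ℤ._-_ (xb (suc d) i) (xb d i))

oneMinusY-*ₛ-yDegree : ∀ {k b} → YDegree≤ k b → YDegree≤ (suc k) (oneMinusY *ₛ b)
oneMinusY-*ₛ-yDegree {k} {b} yb (suc d) (s≤s k<d) i =
  trans (oneMinusY-*ₛ-suc b d i) (cong₂ ℤ._-_ (yb (suc d) (m<n⇒m<1+n k<d) i) (yb d k<d i))

oneMinusYCubed-xFree : XFree oneMinusYCubed
oneMinusYCubed-xFree =
  oneMinusY-*ₛ-xFree {oneMinusY *ₛ oneMinusY} (oneMinusY-*ₛ-xFree {oneMinusY} oneMinusY-xFree)

oneMinusYCubed-yDegree : YDegree≤ 3 oneMinusYCubed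
oneMinusYCubed-yDegree =
  oneMinusY-*ₛ-yDegree {b = oneMinusY *ₛ oneMinusY} (oneMinusY-*ₛ-yDegree {b = oneMinusY} oneMinusY-yDegree)

cubic-convolution : ∀ (u : ℕ → ℤ) m →
  Σ≤ (3 + m) (λ j → u j ℤ.* oneMinusYCubed (3 + m ∸ j) 0) ≡
  Σ≤ 3 (λ j → u (j + m) ℤ.* oneMinusYCubed (3 ∸ j) 0)
cubic-convolution u m =
  trans (subst (λ d → (u ⋆ c) d ≡ Σ≤ 3 (λ j → u (m + j) ℤ.* c (3 ∸ j))) (+-comm m 3)
               (⋆-window 3 m u c λ e 3<e → oneMinusYCubed-yDegree e 3<e 0))
        (Σ≤-cong 3 λ j → cong (λ k → u k ℤ.* c (3 ∸ j)) (+-comm m j))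
  where
  c : ℕ → ℤ
  c k = oneMinusYCubed k 0

third-difference-quadratic : ∀ (u : ℕ → ℤ) s → (∀ n → u (suc n) ≡ u n ℤ.+ + n ℤ.* s) →
  ∀ m → Σ≤ 3 (λ j → u (j + m) ℤ.* oneMinusYCubed (3 ∸ j) 0) ≡ + 0
third-difference-quadratic u s u-suc m
  rewrite u-suc (suc (suc m)) | u-suc (suc m) | u-suc m = identity (u m) (+ m) s
  where
  identity : ∀ t n s →
    t ℤ.* - + 1 ℤ.+ ((t ℤ.+ n ℤ.* s) ℤ.* + 3 ℤ.+ ((t ℤ.+ n ℤ.* s ℤ.+ (+ 1 ℤ.+ n) ℤ.* s) ℤ.* - + 3 ℤ.+
    ((t ℤ.+ n ℤ.* s ℤ.+ (+ 1 ℤ.+ n) ℤ.* s ℤ.+ (+ 2 ℤ.+ n) ℤ.* s) ℤ.* + 1 ℤ.+ + 0))) ≡ + 0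
  identity = solve-∀

-- the coefficients of 1/(1 - y) + v x y²/(1 - y)³
closedForm : ℕ → Series₂
closedForm v d zero = + 1
closedForm v d (suc zero) = + ((d C 2) * v)
closedForm v d (suc (suc i)) = + 0

closedForm-xCoefficient-suc : ∀ v n → closedForm v (suc n) 1 ≡ closedForm v n 1 ℤ.+ + n ℤ.* + v
closedForm-xCoefficient-suc v n = begin
  + ((suc n C 2) * v)                 ≡⟨ cong (λ k → + (k * v)) (nCk+nC[k+1]≡[n+1]C[k+1] n 1) ⟨
  + ((n C 1 + n C 2) * v)             ≡⟨ cong (λ k → + ((k + n C 2) * v)) (nC1≡n n) ⟩
  + ((n + n C 2) * v)                 ≡⟨ cong +_ (*-distribʳ-+ v n (n C 2)) ⟩
  + (n * v + (n C 2) * v)             ≡⟨ ℤ.pos-+ (n * v) ((n C 2) * v) ⟩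
  + (n * v) ℤ.+ + ((n C 2) * v)       ≡⟨ ℤ.+-comm (+ (n * v)) (+ ((n C 2) * v)) ⟩
  + ((n C 2) * v) ℤ.+ + (n * v)       ≡⟨ cong (ℤ._+_ (+ ((n C 2) * v))) (ℤ.pos-* n v) ⟩
  + ((n C 2) * v) ℤ.+ + n ℤ.* + v     ∎
  where open ≡-Reasoning

closedForm-*ₛ-oneMinusYCubed : ∀ v d i → (closedForm v *ₛ oneMinusYCubed) d i ≡ numer v d i
closedForm-*ₛ-oneMinusYCubed v d i =
  trans (*ₛ-xFree {oneMinusYCubed} oneMinusYCubed-xFree (closedForm v) d i) (convolve d i)
  where
  convolve : ∀ d i → Σ≤ d (λ j → closedForm v j i ℤ.* oneMinusYCubed (d ∸ j) 0) ≡ numer v d i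
  convolve zero zero = refl
  convolve zero (suc zero) = refl
  convolve zero (suc (suc i)) = refl
  convolve (suc zero) zero = refl
  convolve (suc zero) (suc zero) = refl
  convolve (suc zero) (suc (suc i)) = refl
  convolve (suc (suc zero)) zero = refl
  -- the sum is + 0 + (+ 0 + (+ (1 * v) * + 1 + + 0))
  convolve (suc (suc zero)) (suc zero) =
    trans (ℤ.+-identityˡ _) (trans (ℤ.+-identityˡ _) (trans (ℤ.+-identityʳ _)
      (trans (ℤ.*-identityʳ _) (cong +_ (*-identityˡ v)))))
  convolve (suc (suc zero)) (suc (suc i)) = refl
  convolve (suc (suc (suc m))) zero = cubic-convolution (λ j → closedForm v j 0) m
  convolve (suc (suc (suc m))) (suc zero) =
    trans (cubic-convolution (λ j → closedForm v j 1) m)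
          (third-difference-quadratic (λ j → closedForm v j 1) (+ v) (closedForm-xCoefficient-suc v) m)
  convolve (suc (suc (suc m))) (suc (suc i)) = cubic-convolution (λ j → closedForm v j (suc (suc i))) m

genFun≗closedForm : ∀ {v} → 3 ≤ v → ∀ d i → genFun v d i ≡ closedForm v d i
genFun≗closedForm _ zero zero = refl
genFun≗closedForm _ zero (suc zero) = refl
genFun≗closedForm _ zero (suc (suc i)) = refl
genFun≗closedForm 3≤v (suc d) zero = cong +_ (count-noDescent (suc d) (≤-trans (n≤1+n 2) 3≤v))
genFun≗closedForm 3≤v (suc d) (suc zero) = cong +_ (count-oneDescent d 3≤v)
genFun≗closedForm {v} _ (suc d) (suc (suc i)) = cong +_ (count-manyDescents v (suc d) i)

theorem3p8 : (v : ℕ) → 4 ≤ v →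
    (d i : ℕ) → (genFun v *ₛ oneMinusYCubed) d i ≡ numer v d i
theorem3p8 v 4≤v d i = begin
  (genFun v *ₛ oneMinusYCubed) d i     ≡⟨ *ₛ-congˡ oneMinusYCubed (genFun≗closedForm (<⇒≤ 4≤v)) d i ⟩
  (closedForm v *ₛ oneMinusYCubed) d i ≡⟨ closedForm-*ₛ-oneMinusYCubed v d i ⟩
  numer v d i                          ∎
  where open ≡-Reasoning
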